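{- Let $s\ge 2$ and let $F$ be an optimal $s$-club cluster edge-deletion set of a graph $G$. Let $T$ be a twin class in $G$, i.e., a set of vertices such that for all $x,y\in T$ either $N[x]=N[y]$ or $N(x)=N(y)$. Then there exists another optimal solution $F'$ such that in $G-F'$ all but at most one connected component contain at most one vertex of $T$.
   Context: For a graph $G$, an $s$-club cluster edge-deletion set is a set $F\subseteq E(G)$ such that every connected component of $G-F$ has diameter at most $s$; it is optimal if it has minimum size among all such sets. $N(v)$ is the open and $N[v]=N(v)\cup\{v\}$ the closed neighborhood of $v$. -}

module Defs where

open import Data.Nat using (ℕ; zero; suc; _+_; _≤_; _<ᵇ_)
open import Data.Fin using (Fin; toℕ; _≟_)
open import Data.Bool using (Bool; true; false; _∧_; _∨_; not; if_then_else_)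
open import Data.List using (List; map; allFin)
open import Data.Nat.ListAction using (sum)
open import Data.Product using (Σ; ∃; _×_; _,_)
open import Data.Sum using (_⊎_)
open import Relation.Binary.PropositionalEquality using (_≡_; _≢_)
open import Relation.Nullary.Decidable using (⌊_⌋)

record Graph (n : ℕ) : Set where
  field
    adj   : Fin n → Fin n → Bool
    sym   : ∀ u v → adj u v ≡ adj v u
    irrefl : ∀ v → adj v v ≡ false
open Graph public

record EdgeSet {n : ℕ} (G : Graph n) : Set where
  field
    mem    : Fin n → Fin n → Bool
    memSym : ∀ u v → mem u v ≡ mem v u
    sub    : ∀ u v → mem u v ≡ true → adj G u v ≡ true
open EdgeSet public

size : {n : ℕ} {G : Graph n} → EdgeSet G → ℕ
size {n} F = sum (map (λ u → sum (map (λ v →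
  if (toℕ u <ᵇ toℕ v) ∧ mem F u v then 1 else 0) (allFin n))) (allFin n))

adjDel : {n : ℕ} (G : Graph n) → EdgeSet G → Fin n → Fin n → Bool
adjDel G F u v = adj G u v ∧ not (mem F u v)

data Walk {n : ℕ} (A : Fin n → Fin n → Bool) : Fin n → Fin n → ℕ → Set where
  here : ∀ {u} → Walk A u u zero
  step : ∀ {u v w k} → A u v ≡ true → Walk A v w k → Walk A u w (suc k)

Connected : {n : ℕ} → (Fin n → Fin n → Bool) → Fin n → Fin n → Set
Connected A u v = ∃ λ k → Walk A u v k

DistLe : {n : ℕ} → (Fin n → Fin n → Bool) → ℕ → Fin n → Fin n → Set
DistLe A s u v = ∃ λ k → k ≤ s × Walk A u v k

IsSClubCED : {n : ℕ} (s : ℕ) (G : Graph n) → EdgeSet G → Set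
IsSClubCED s G F = ∀ u v → Connected (adjDel G F) u v → DistLe (adjDel G F) s u v

IsOptimal : {n : ℕ} (s : ℕ) (G : Graph n) → EdgeSet G → Set
IsOptimal s G F = IsSClubCED s G F × (∀ F' → IsSClubCED s G F' → size F ≤ size F')

N : {n : ℕ} → Graph n → Fin n → Fin n → Bool
N G x z = adj G x z

N[_] : {n : ℕ} → Graph n → Fin n → Fin n → Bool
N[ G ] x z = ⌊ x ≟ z ⌋ ∨ adj G x z

IsTwinClass : {n : ℕ} → Graph n → (Fin n → Bool) → Set
IsTwinClass G T = ∀ x y → T x ≡ true → T y ≡ true →
  (∀ z → N[ G ] x z ≡ N[ G ] y z) ⊎ (∀ z → N G x z ≡ N G y z)

-- All but at most one connected component of G - F contain at most one
-- vertex of T: any two components each containing two distinct vertices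
-- of T coincide.
AtMostOneComponentWithTwoOf : {n : ℕ} (G : Graph n) → EdgeSet G → (Fin n → Bool) → Set
AtMostOneComponentWithTwoOf G F T =
  ∀ x₁ x₂ y₁ y₂ → T x₁ ≡ true → T x₂ ≡ true → T y₁ ≡ true → T y₂ ≡ true →
  x₁ ≢ x₂ → y₁ ≢ y₂ →
  Connected (adjDel G F) x₁ x₂ → Connected (adjDel G F) y₁ y₂ →
  Connected (adjDel G F) x₁ y₁

-- Let x, x′ be distinct vertices of T in one component of G − F and y, y′ distinct vertices of T
-- in another. Moving y into the component of x (and, symmetrically, x into the component of y)
-- and deleting exactly the edges between the new parts gives an s-club cluster deletion set:
-- y′ takes over y's role in its old component, y has x's neighbours in its new one, and y reaches
-- x through a common neighbour in 2 ≤ s steps. Since x and y have the same neighbours outside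
-- {x, y}, the two moves together cost at most 2|F|, so by optimality of F moving y costs at most
-- |F|. Each move brings one more vertex of T into the component of x, so after finitely many
-- moves every component holding two vertices of T is that of x.

module Submission where

open import Defs hiding (sym)
open import Data.Bool using (Bool; true; false; _∧_; _∨_; not; if_then_else_)
open import Data.Bool.Properties using (∧-zeroʳ) renaming (_≟_ to _≟ᵇ_)
open import Data.Empty using (⊥-elim)
open import Data.Fin using (Fin; zero; suc; toℕ; _≟_)
open import Data.Fin.Permutation using (transpose; _⟨$⟩ʳ_)
open import Data.Fin.Properties using (any?; toℕ-injective)
open import Data.List using (map; allFin; tabulate)
open import Data.List.Properties using (map-tabulate)
import Data.Nat.ListAction as List
open import Data.Nat using (ℕ; zero; suc; _+_; _≤_; _<_; _<ᵇ_; z≤n; s≤s)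
open import Data.Nat.Properties
  using (_<?_; ≤-refl; ≤-trans; ≤-reflexive; <-≤-trans; ≤-pred; m≤n⇒m≤1+n; m≤n⇒m<n∨m≡n;
         ≮⇒≥; <⇒≱; <-cmp; +-mono-≤; +-mono-<; +-mono-<-≤; +-mono-≤-<; +-cancelʳ-≤; +-monoʳ-≤;
         +-comm; +-identityʳ; +-0-commutativeMonoid)
open import Algebra.Properties.CommutativeMonoid.Sum +-0-commutativeMonoid
  using (sum; sum-cong-≗; ∑-distrib-+; ∑-comm; ∑-permute)
open import Data.Nat.Tactic.RingSolver using (solve-∀)
open import Data.Product using (Σ; ∃; ∃-syntax; _×_; _,_; proj₁; proj₂)
open import Data.Sum using (_⊎_; inj₁; inj₂)
open import Function using (_∘_; _on_; mk⇔)
open import Relation.Binary using (tri<; tri≈; tri>)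
open import Relation.Binary.PropositionalEquality
open import Relation.Nullary using (Dec; yes; no; ¬_; does)
open import Relation.Nullary.Decidable
  using (⌊_⌋; map′; _×-dec_; _⊎-dec_; ¬?; dec-true; dec-false; does-⇔; isYes≗does)

private
  variable
    n : ℕ

𝟙 : Bool → ℕ
𝟙 b = if b then 1 else 0

𝟙-∧-not-antitone : ∀ a {p q} → (p ≡ true → q ≡ true) → 𝟙 (a ∧ not q) ≤ 𝟙 (a ∧ not p)
𝟙-∧-not-antitone false p⇒q = z≤n
𝟙-∧-not-antitone true {true} p⇒q rewrite p⇒q refl = z≤n
𝟙-∧-not-antitone true {false} {true} p⇒q = z≤n
𝟙-∧-not-antitone true {false} {false} p⇒q = ≤-refl

𝟙-∧-not-true : ∀ a → 𝟙 (a ∧ not true) ≡ 0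
𝟙-∧-not-true a = cong 𝟙 (∧-zeroʳ a)

𝟙≤1 : ∀ b → 𝟙 b ≤ 1
𝟙≤1 true = ≤-refl
𝟙≤1 false = z≤n

∧-trueˡ : ∀ {a b} → a ∧ b ≡ true → a ≡ true
∧-trueˡ {true} _ = refl

does≡true⇒ : ∀ {P : Set} (d : Dec P) → does d ≡ true → P
does≡true⇒ (yes p) _ = p

+-interchange : ∀ a b → (a + b) + (a + b) ≡ (a + a) + (b + b)
+-interchange = solve-∀

m+n≤o+o⇒o≤n⇒m≤o : ∀ {m n o} → m + n ≤ o + o → o ≤ n → m ≤ o
m+n≤o+o⇒o≤n⇒m≤o {m} {n} {o} le o≤n = +-cancelʳ-≤ n m o (≤-trans le (+-monoʳ-≤ o o≤n))

m+m≤n+n⇒m≤n : ∀ {m n} → m + m ≤ n + n → m ≤ n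
m+m≤n+n⇒m≤n le = ≮⇒≥ λ n<m → <⇒≱ (+-mono-< n<m n<m) le

<⇒<ᵇ≡true : ∀ {m n} → m < n → (m <ᵇ n) ≡ true
<⇒<ᵇ≡true {m} {n} = dec-true (m <? n)

≮⇒<ᵇ≡false : ∀ {m n} → ¬ m < n → (m <ᵇ n) ≡ false
≮⇒<ᵇ≡false {m} {n} = dec-false (m <? n)

∑-mono-≤ : {f g : Fin n → ℕ} → (∀ i → f i ≤ g i) → sum f ≤ sum g
∑-mono-≤ {zero} f≤g = z≤n
∑-mono-≤ {suc n} f≤g = +-mono-≤ (f≤g zero) (∑-mono-≤ (f≤g ∘ suc))

∑-mono-< : {f g : Fin n → ℕ} → (∀ i → f i ≤ g i) → ∀ j → f j < g j → sum f < sum g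
∑-mono-< f≤g zero fj<gj = +-mono-<-≤ fj<gj (∑-mono-≤ (f≤g ∘ suc))
∑-mono-< f≤g (suc j) fj<gj = +-mono-≤-< (f≤g zero) (∑-mono-< (f≤g ∘ suc) j fj<gj)

sum-tabulate : (f : Fin n → ℕ) → List.sum (tabulate f) ≡ sum f
sum-tabulate {zero} f = refl
sum-tabulate {suc n} f = cong (f zero +_) (sum-tabulate (f ∘ suc))

sum-map-allFin : (f : Fin n → ℕ) → List.sum (map f (allFin n)) ≡ sum f
sum-map-allFin {n} f = trans (cong List.sum (map-tabulate {n = n} (λ i → i) f)) (sum-tabulate f)

∑² : (Fin n → Fin n → ℕ) → ℕ
∑² h = sum λ u → sum (h u)

∑²-mono-≤ : {g h : Fin n → Fin n → ℕ} → (∀ u v → g u v ≤ h u v) → ∑² g ≤ ∑² h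
∑²-mono-≤ g≤h = ∑-mono-≤ λ u → ∑-mono-≤ (g≤h u)

∑²-distrib-+ : (g h : Fin n → Fin n → ℕ) → ∑² (λ u v → g u v + h u v) ≡ ∑² g + ∑² h
∑²-distrib-+ g h = trans (sum-cong-≗ λ u → ∑-distrib-+ (g u) (h u))
  (∑-distrib-+ (λ u → sum (g u)) (λ u → sum (h u)))

∑²-transpose : ∀ (x y : Fin n) h →
  ∑² (λ u v → h (transpose x y ⟨$⟩ʳ u) (transpose x y ⟨$⟩ʳ v)) ≡ ∑² h
∑²-transpose x y h = sym (trans (∑-permute (λ u → sum (h u)) (transpose x y))
  (sum-cong-≗ λ u → ∑-permute (h (transpose x y ⟨$⟩ʳ u)) (transpose x y)))

∑²-orbit : ∀ (x y : Fin n) h →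
  ∑² (λ u v → h u v + h (transpose x y ⟨$⟩ʳ u) (transpose x y ⟨$⟩ʳ v)) ≡ ∑² h + ∑² h
∑²-orbit x y h = trans (∑²-distrib-+ h _) (cong (∑² h +_) (∑²-transpose x y h))

module _ {A : Fin n → Fin n → Bool} where

  _++ʷ_ : ∀ {u v w k m} → Walk A u v k → Walk A v w m → Walk A u w (k + m)
  here ++ʷ q = q
  step e p ++ʷ q = step e (p ++ʷ q)

  _∷ʳʷ_ : ∀ {u v w k} → Walk A u v k → A v w ≡ true → Walk A u w (suc k)
  here ∷ʳʷ e = step e here
  step e′ p ∷ʳʷ e = step e′ (p ∷ʳʷ e)

  reverseʷ : (∀ u v → A u v ≡ A v u) → ∀ {u v k} → Walk A u v k → Walk A v u k
  reverseʷ A-sym here = here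
  reverseʷ A-sym (step {u} {v} e p) = reverseʷ A-sym p ∷ʳʷ trans (A-sym v u) e

  walk? : ∀ k u v → Dec (Walk A u v k)
  walk? zero u v = map′ (λ { refl → here }) (λ { here → refl }) (u ≟ v)
  walk? (suc k) u v = map′ (λ (w , e , p) → step e p) (λ { (step e p) → _ , e , p })
    (any? λ w → (A u w ≟ᵇ true) ×-dec walk? k w v)

  distLe? : ∀ s u v → Dec (DistLe A s u v)
  distLe? zero u v = map′ (λ p → zero , z≤n , p) (λ { (zero , _ , p) → p ; (suc _ , () , _) })
    (walk? zero u v)
  distLe? (suc s) u v = map′ widen narrow (walk? (suc s) u v ⊎-dec distLe? s u v)
    where
    widen : Walk A u v (suc s) ⊎ DistLe A s u v → DistLe A (suc s) u v
    widen (inj₁ p) = suc s , ≤-refl , p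
    widen (inj₂ (k , k≤s , p)) = k , m≤n⇒m≤1+n k≤s , p
    narrow : DistLe A (suc s) u v → Walk A u v (suc s) ⊎ DistLe A s u v
    narrow (k , k≤1+s , p) with m≤n⇒m<n∨m≡n k≤1+s
    ... | inj₁ k<1+s = inj₂ (k , ≤-pred k<1+s , p)
    ... | inj₂ refl = inj₁ p

  distLe-sym : (∀ u v → A u v ≡ A v u) → ∀ {s u v} → DistLe A s u v → DistLe A s v u
  distLe-sym A-sym (k , k≤s , p) = k , k≤s , reverseʷ A-sym p

  distLe⇒connected : ∀ {s u v} → DistLe A s u v → Connected A u v
  distLe⇒connected (k , _ , p) = k , p

  firstStep : ∀ {u v k} → u ≢ v → Walk A u v k → ∃ λ z → A u z ≡ true
  firstStep u≢v here = ⊥-elim (u≢v refl)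
  firstStep u≢v (step e p) = _ , e

module _ {A A′ : Fin n → Fin n → Bool} (h : Fin n → Fin n)
  (h-hom : ∀ {p q} → A p q ≡ true → h p ≡ h q ⊎ A′ (h p) (h q) ≡ true) where

  map-walk : ∀ {u v k} → Walk A u v k → ∃[ j ] j ≤ k × Walk A′ (h u) (h v) j
  map-walk here = 0 , z≤n , here
  map-walk {v = v} (step e p) with map-walk p | h-hom e
  ... | j , j≤k , p′ | inj₁ eq = j , m≤n⇒m≤1+n j≤k , subst (λ t → Walk A′ t (h v) j) (sym eq) p′
  ... | j , j≤k , p′ | inj₂ e′ = suc j , s≤s j≤k , step e′ p′

  map-distLe : ∀ {s u v} → DistLe A s u v → DistLe A′ s (h u) (h v)
  map-distLe (k , k≤s , p) with map-walk p
  ... | j , j≤k , p′ = j , ≤-trans j≤k k≤s , p′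

module Connectivity {A : Fin n → Fin n → Bool} (A-sym : ∀ u v → A u v ≡ A v u) where

  connected-refl : ∀ u → Connected A u u
  connected-refl u = 0 , here

  connected-sym : ∀ {u v} → Connected A u v → Connected A v u
  connected-sym (k , p) = k , reverseʷ A-sym p

  connected-trans : ∀ {u v w} → Connected A u v → Connected A v w → Connected A u w
  connected-trans (k , p) (m , q) = k + m , p ++ʷ q

  edge⇒connected : ∀ {u v} → A u v ≡ true → Connected A u v
  edge⇒connected e = 1 , step e here

module ComponentsOf {A : Fin n → Fin n → Bool} (A-sym : ∀ u v → A u v ≡ A v u)
  (s : ℕ) (bounded : ∀ u v → Connected A u v → DistLe A s u v) where

  open Connectivity A-sym public

  connected? : ∀ u v → Dec (Connected A u v)
  connected? u v = map′ distLe⇒connected (bounded u v) (distLe? s u v)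

  sameComponent : Fin n → Fin n → Bool
  sameComponent u v = does (connected? u v)

  sameComponent⇒connected : ∀ {u v} → sameComponent u v ≡ true → Connected A u v
  sameComponent⇒connected {u} {v} = does≡true⇒ (connected? u v)

  connected⇒sameComponent : ∀ {u v} → Connected A u v → sameComponent u v ≡ true
  connected⇒sameComponent {u} {v} = dec-true (connected? u v)

  ¬connected⇒¬sameComponent : ∀ {u v} → ¬ Connected A u v → sameComponent u v ≡ false
  ¬connected⇒¬sameComponent {u} {v} = dec-false (connected? u v)

  sameComponent-refl : ∀ u → sameComponent u u ≡ true
  sameComponent-refl u = connected⇒sameComponent (connected-refl u)

  sameComponent-sym : ∀ u v → sameComponent u v ≡ sameComponent v u
  sameComponent-sym u v =
    does-⇔ (mk⇔ connected-sym connected-sym) (connected? u v) (connected? v u)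

  sameComponent-trans : ∀ {u v w} → sameComponent u v ≡ true → sameComponent v w ≡ true →
    sameComponent u w ≡ true
  sameComponent-trans uv vw = connected⇒sameComponent
    (connected-trans (sameComponent⇒connected uv) (sameComponent⇒connected vw))

adjDel-sym : (G : Graph n) (E : EdgeSet G) → ∀ u v → adjDel G E u v ≡ adjDel G E v u
adjDel-sym G E u v = cong₂ (λ a m → a ∧ not m) (Graph.sym G u v) (memSym E u v)

mem-irrefl : {G : Graph n} (E : EdgeSet G) → ∀ u → mem E u u ≡ false
mem-irrefl {G = G} E u with mem E u u in eq
... | true = trans (sym (sub E u u eq)) (irrefl G u)
... | false = refl

adj⇒≢ : (G : Graph n) → ∀ {u v} → adj G u v ≡ true → u ≢ v
adj⇒≢ G {u} e refl with () ← trans (sym e) (irrefl G u)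

cut : (G : Graph n) (Q : Fin n → Fin n → Bool) → (∀ u v → Q u v ≡ Q v u) → EdgeSet G
cut G Q Q-sym = record
  { mem = λ u v → adj G u v ∧ not (Q u v)
  ; memSym = λ u v → cong₂ (λ a q → a ∧ not q) (Graph.sym G u v) (Q-sym u v)
  ; sub = λ u v → ∧-trueˡ
  }

module _ (G : Graph n) {Q : Fin n → Fin n → Bool} (Q-sym : ∀ u v → Q u v ≡ Q v u) where

  cut-edge⁺ : ∀ {u v} → adj G u v ≡ true → Q u v ≡ true → adjDel G (cut G Q Q-sym) u v ≡ true
  cut-edge⁺ e q rewrite e | q = refl

  cut-edge⁻ : ∀ {u v} → adjDel G (cut G Q Q-sym) u v ≡ true → Q u v ≡ true
  cut-edge⁻ {u} {v} with adj G u v | Q u v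
  ... | true | true = λ _ → refl

  cut-walk⇒related : (∀ u → Q u u ≡ true) →
    (∀ {u v w} → Q u v ≡ true → Q v w ≡ true → Q u w ≡ true) →
    ∀ {u v k} → Walk (adjDel G (cut G Q Q-sym)) u v k → Q u v ≡ true
  cut-walk⇒related Q-refl Q-trans here = Q-refl _
  cut-walk⇒related Q-refl Q-trans (step e p) =
    Q-trans (cut-edge⁻ e) (cut-walk⇒related Q-refl Q-trans p)

pairs : (Fin n → Fin n → Bool) → ℕ
pairs m = ∑² λ u v → 𝟙 (m u v)

cutCost : (G : Graph n) → (Fin n → Fin n → Bool) → ℕ
cutCost G Q = ∑² λ u v → 𝟙 (adj G u v ∧ not (Q u v))

pairs-size : {G : Graph n} (E : EdgeSet G) → pairs (mem E) ≡ size E + size E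
pairs-size {n} E = begin
  pairs (mem E)                         ≡⟨ sum-cong-≗ (λ u → sum-cong-≗ (ordered-split u)) ⟩
  ∑² (λ u v → before u v + before v u)  ≡⟨ ∑²-distrib-+ before (λ u v → before v u) ⟩
  ∑² before + ∑² (λ u v → before v u)   ≡⟨ cong (∑² before +_) (∑-comm (λ v u → before v u)) ⟨
  ∑² before + ∑² before                 ≡⟨ cong₂ _+_ size≡ size≡ ⟨
  size E + size E                       ∎
  where
  open ≡-Reasoning
  before : Fin n → Fin n → ℕ
  before u v = 𝟙 ((toℕ u <ᵇ toℕ v) ∧ mem E u v)
  ordered-split : ∀ u v → 𝟙 (mem E u v) ≡ before u v + before v u
  ordered-split u v with <-cmp (toℕ u) (toℕ v)
  ... | tri< u<v _ v≮u rewrite <⇒<ᵇ≡true u<v | ≮⇒<ᵇ≡false v≮u = sym (+-identityʳ _)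
  ... | tri> u≮v _ v<u rewrite <⇒<ᵇ≡true v<u | ≮⇒<ᵇ≡false u≮v | memSym E u v = refl
  ... | tri≈ _ u≡v _ rewrite toℕ-injective u≡v | mem-irrefl E v | ∧-zeroʳ (toℕ v <ᵇ toℕ v) = refl
  size≡ : size E ≡ ∑² before
  size≡ = trans (sum-map-allFin {n} λ u → List.sum (map (before u) (allFin n)))
    (sum-cong-≗ λ u → sum-map-allFin (before u))

-- Covers both true twins (N[x] = N[y]) and false twins (N(x) = N(y)).
Twins : Graph n → Fin n → Fin n → Set
Twins G x y = ∀ z → z ≢ x → z ≢ y → adj G x z ≡ adj G y z

twins-sym : {G : Graph n} {x y : Fin n} → Twins G x y → Twins G y x
twins-sym x~y z z≢y z≢x = sym (x~y z z≢x z≢y)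

twinClass⇒twins : {G : Graph n} {T : Fin n → Bool} → IsTwinClass G T →
  ∀ {x y} → T x ≡ true → T y ≡ true → Twins G x y
twinClass⇒twins {G = G} twinClass {x} {y} Tx Ty z z≢x z≢y with twinClass x y Tx Ty
... | inj₂ same-open = same-open z
... | inj₁ same-closed = begin
  adj G x z                 ≡⟨ cong (_∨ adj G x z) (isYes-false z≢x) ⟨
  N[ G ] x z                ≡⟨ same-closed z ⟩
  N[ G ] y z                ≡⟨ cong (_∨ adj G y z) (isYes-false z≢y) ⟩
  adj G y z                 ∎
  where
  open ≡-Reasoning
  isYes-false : ∀ {w} → z ≢ w → ⌊ w ≟ z ⌋ ≡ false
  isYes-false {w} z≢w = trans (isYes≗does (w ≟ z)) (dec-false (w ≟ z) (z≢w ∘ sym))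

replace : Fin n → Fin n → Fin n → Fin n
replace b a v = if does (v ≟ b) then a else v

replace-target : ∀ (b a : Fin n) → replace b a b ≡ a
replace-target b a rewrite dec-true (b ≟ b) refl = refl

replace-other : ∀ {b a v : Fin n} → v ≢ b → replace b a v ≡ v
replace-other {b = b} {v = v} v≢b rewrite dec-false (v ≟ b) v≢b = refl

replace-fixes-target : ∀ (b a : Fin n) → replace b a a ≡ a
replace-fixes-target b a with does (a ≟ b)
... | true = refl
... | false = refl

replace-≢ : ∀ {b a : Fin n} v → a ≢ b → replace b a v ≢ b
replace-≢ {b = b} v a≢b with v ≟ b
... | yes _ = a≢b
... | no v≢b = v≢b

replace-twin-adj : {G : Graph n} {b b′ : Fin n} → Twins G b b′ → ∀ {p q} →
  replace b b′ p ≢ replace b b′ q → adj G (replace b b′ p) (replace b b′ q) ≡ adj G p q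
replace-twin-adj {G = G} {b} {b′} b~b′ {p} {q} rp≢rq with p ≟ b | q ≟ b
... | yes refl | yes refl = ⊥-elim (rp≢rq refl)
... | yes refl | no q≢b = sym (b~b′ q q≢b (rp≢rq ∘ sym))
... | no p≢b | yes refl = begin
  adj G p b′ ≡⟨ Graph.sym G p b′ ⟩
  adj G b′ p ≡⟨ b~b′ p p≢b rp≢rq ⟨
  adj G b p  ≡⟨ Graph.sym G b p ⟩
  adj G p b  ∎
  where open ≡-Reasoning
... | no _ | no _ = refl

module _ (x y : Fin n) where

  transpose-left : transpose x y ⟨$⟩ʳ x ≡ y
  transpose-left with x ≟ x
  ... | yes _ = refl
  ... | no x≢x = ⊥-elim (x≢x refl)

  transpose-right : transpose x y ⟨$⟩ʳ y ≡ x
  transpose-right with y ≟ x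
  ... | yes y≡x = y≡x
  ... | no _ with y ≟ y
  ...   | yes _ = refl
  ...   | no y≢y = ⊥-elim (y≢y refl)

  transpose-other : ∀ {o} → o ≢ x → o ≢ y → transpose x y ⟨$⟩ʳ o ≡ o
  transpose-other {o} o≢x o≢y with o ≟ x
  ... | yes o≡x = ⊥-elim (o≢x o≡x)
  ... | no _ with o ≟ y
  ...   | yes o≡y = ⊥-elim (o≢y o≡y)
  ...   | no _ = refl

module _ (G : Graph n) {P : Fin n → Fin n → Bool} (P-sym : ∀ u v → P u v ≡ P v u)
  {x y : Fin n} (x~y : Twins G x y) (Pxx : P x x ≡ true) (Pyy : P y y ≡ true) where

  -- Only pairs meeting {x, y} change. Grouping every ordered pair with its image under the
  -- transposition (x y), the two relocations together cut exactly twice what P cuts on each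
  -- orbit, except for the pair {x, y} itself, which neither of them cuts.
  private
    σ : Fin n → Fin n
    σ = transpose x y ⟨$⟩ʳ_

    cost : (Fin n → Fin n → Bool) → Fin n → Fin n → ℕ
    cost Q u v = 𝟙 (adj G u v ∧ not (Q u v))

    merged : Fin n → Fin n → ℕ
    merged u v = cost (P on replace y x) u v + cost (P on replace x y) u v

    orbit : (Fin n → Fin n → ℕ) → Fin n → Fin n → ℕ
    orbit h u v = h u v + h (σ u) (σ v)

    InPair : Fin n → Set
    InPair u = u ≡ x ⊎ u ≡ y

    Outside : Fin n → Set
    Outside u = u ≢ x × u ≢ y

    classify : ∀ u → InPair u ⊎ Outside u
    classify u with u ≟ x | u ≟ y
    ... | yes u≡x | _ = inj₁ (inj₁ u≡x)
    ... | no _ | yes u≡y = inj₁ (inj₂ u≡y)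
    ... | no u≢x | no u≢y = inj₂ (u≢x , u≢y)

    σ-pair : ∀ {u} → InPair u → InPair (σ u)
    σ-pair (inj₁ refl) = inj₂ (transpose-left x y)
    σ-pair (inj₂ refl) = inj₁ (transpose-right x y)

    σ-outside : ∀ {o} → Outside o → σ o ≡ o
    σ-outside (o≢x , o≢y) = transpose-other x y o≢x o≢y

    replace-pairˡ : ∀ {u} → InPair u → replace y x u ≡ x
    replace-pairˡ (inj₁ refl) = replace-fixes-target y x
    replace-pairˡ (inj₂ refl) = replace-target y x

    replace-pairʳ : ∀ {u} → InPair u → replace x y u ≡ y
    replace-pairʳ (inj₁ refl) = replace-target x y
    replace-pairʳ (inj₂ refl) = replace-fixes-target x y

    adj-pair : ∀ {o v} → Outside o → InPair v → adj G o v ≡ adj G o y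
    adj-pair {o} (o≢x , o≢y) (inj₁ refl) =
      trans (Graph.sym G o x) (trans (x~y o o≢x o≢y) (Graph.sym G y o))
    adj-pair (o≢x , o≢y) (inj₂ refl) = refl

    cost-sym : ∀ {Q} → (∀ u v → Q u v ≡ Q v u) → ∀ u v → cost Q u v ≡ cost Q v u
    cost-sym Q-sym u v = cong₂ (λ a q → 𝟙 (a ∧ not q)) (Graph.sym G u v) (Q-sym u v)

    merged-sym : ∀ u v → merged u v ≡ merged v u
    merged-sym u v = cong₂ _+_ (cost-sym (λ p q → P-sym (replace y x p) (replace y x q)) u v)
                               (cost-sym (λ p q → P-sym (replace x y p) (replace x y q)) u v)

    orbit-sym : ∀ {h} → (∀ u v → h u v ≡ h v u) → ∀ u v → orbit h u v ≡ orbit h v u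
    orbit-sym h-sym u v = cong₂ _+_ (h-sym u v) (h-sym (σ u) (σ v))

    merged-pair : ∀ {u v} → InPair u → InPair v → merged u v ≡ 0
    merged-pair {u} {v} u∈ v∈ = cong₂ _+_
      (trans (cong (λ q → 𝟙 (adj G u v ∧ not q))
        (trans (cong₂ P (replace-pairˡ u∈) (replace-pairˡ v∈)) Pxx)) (𝟙-∧-not-true _))
      (trans (cong (λ q → 𝟙 (adj G u v ∧ not q))
        (trans (cong₂ P (replace-pairʳ u∈) (replace-pairʳ v∈)) Pyy)) (𝟙-∧-not-true _))

    merged-outside-pair : ∀ {o v} → Outside o → InPair v → merged o v ≡ cost P o x + cost P o y
    merged-outside-pair {o} o∉@(o≢x , o≢y) v∈ = cong₂ _+_
      (cong₂ (λ a q → 𝟙 (a ∧ not q)) (trans (adj-pair o∉ v∈) (sym (adj-pair o∉ (inj₁ refl))))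
        (cong₂ P (replace-other o≢y) (replace-pairˡ v∈)))
      (cong₂ (λ a q → 𝟙 (a ∧ not q)) (adj-pair o∉ v∈)
        (cong₂ P (replace-other o≢x) (replace-pairʳ v∈)))

    orbit-cost-outside-pair : ∀ {o v} → Outside o → InPair v →
      orbit (cost P) o v ≡ cost P o x + cost P o y
    orbit-cost-outside-pair o∉ (inj₁ refl) rewrite σ-outside o∉ | transpose-left x y = refl
    orbit-cost-outside-pair {o} o∉ (inj₂ refl) rewrite σ-outside o∉ | transpose-right x y =
      +-comm (cost P o y) (cost P o x)

    orbit-outside-pair : ∀ {o v} → Outside o → InPair v →
      orbit merged o v ≡ orbit (cost P) o v + orbit (cost P) o v
    orbit-outside-pair {o} {v} o∉ v∈ = begin
      merged o v + merged (σ o) (σ v)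
        ≡⟨ cong₂ _+_ (merged-outside-pair o∉ v∈)
             (trans (cong (λ t → merged t (σ v)) (σ-outside o∉))
                    (merged-outside-pair o∉ (σ-pair v∈))) ⟩
      (cost P o x + cost P o y) + (cost P o x + cost P o y)
        ≡⟨ cong₂ _+_ (orbit-cost-outside-pair o∉ v∈) (orbit-cost-outside-pair o∉ v∈) ⟨
      orbit (cost P) o v + orbit (cost P) o v ∎
      where open ≡-Reasoning

    orbit-outside : ∀ {u v} → Outside u → Outside v →
      orbit merged u v ≡ orbit (cost P) u v + orbit (cost P) u v
    orbit-outside {u} {v} (u≢x , u≢y) (v≢x , v≢y)
      rewrite σ-outside (u≢x , u≢y) | σ-outside (v≢x , v≢y)
            | replace-other {a = x} u≢y | replace-other {a = x} v≢y
            | replace-other {a = y} u≢x | replace-other {a = y} v≢x = refl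

    orbit-bound : ∀ u v → orbit merged u v ≤ orbit (cost P) u v + orbit (cost P) u v
    orbit-bound u v with classify u | classify v
    ... | inj₁ u∈ | inj₁ v∈ =
      ≤-trans (≤-reflexive (cong₂ _+_ (merged-pair u∈ v∈) (merged-pair (σ-pair u∈) (σ-pair v∈))))
              z≤n
    ... | inj₂ u∉ | inj₁ v∈ = ≤-reflexive (orbit-outside-pair u∉ v∈)
    ... | inj₁ u∈ | inj₂ v∉ = ≤-reflexive (begin
      orbit merged u v                         ≡⟨ orbit-sym merged-sym u v ⟩
      orbit merged v u                         ≡⟨ orbit-outside-pair v∉ u∈ ⟩
      orbit (cost P) v u + orbit (cost P) v u  ≡⟨ cong₂ _+_ flip flip ⟩
      orbit (cost P) u v + orbit (cost P) u v  ∎)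
      where
      open ≡-Reasoning
      flip : orbit (cost P) v u ≡ orbit (cost P) u v
      flip = orbit-sym (cost-sym P-sym) v u
    ... | inj₂ u∉ | inj₂ v∉ = ≤-reflexive (orbit-outside u∉ v∉)

  cutCost-replace :
    cutCost G (P on replace y x) + cutCost G (P on replace x y) ≤ cutCost G P + cutCost G P
  cutCost-replace = m+m≤n+n⇒m≤n (begin
    (C₁ + C₂) + (C₁ + C₂)
      ≡⟨ cong₂ _+_ merged-total merged-total ⟨
    ∑² merged + ∑² merged                   ≡⟨ ∑²-orbit x y merged ⟨
    ∑² (orbit merged)                       ≤⟨ ∑²-mono-≤ orbit-bound ⟩
    ∑² (λ u v → orbit (cost P) u v + orbit (cost P) u v)
      ≡⟨ ∑²-distrib-+ (orbit (cost P)) (orbit (cost P)) ⟩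
    ∑² (orbit (cost P)) + ∑² (orbit (cost P))
      ≡⟨ cong₂ _+_ (∑²-orbit x y (cost P)) (∑²-orbit x y (cost P)) ⟩
    (cutCost G P + cutCost G P) + (cutCost G P + cutCost G P) ∎)
    where
    open Data.Nat.Properties.≤-Reasoning
    C₁ C₂ : ℕ
    C₁ = cutCost G (P on replace y x)
    C₂ = cutCost G (P on replace x y)
    merged-total : ∑² merged ≡ C₁ + C₂
    merged-total = ∑²-distrib-+ (cost (P on replace y x)) (cost (P on replace x y))

module Relocation {s : ℕ} (G : Graph n) (F : EdgeSet G) (valid : IsSClubCED s G F) where

  open ComponentsOf (adjDel-sym G F) s valid public

  private
    A : Fin n → Fin n → Bool
    A = adjDel G F

  relocated-sym : ∀ b a u v →
    (sameComponent on replace b a) u v ≡ (sameComponent on replace b a) v u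
  relocated-sym b a u v = sameComponent-sym (replace b a u) (replace b a v)

  -- The cut of the partition into components of G − F after b has been moved into the part of a.
  relocate : Fin n → Fin n → EdgeSet G
  relocate b a = cut G (sameComponent on replace b a) (relocated-sym b a)

  cutCost-components : cutCost G sameComponent ≤ pairs (mem F)
  cutCost-components = ∑²-mono-≤ λ u v → bound u v
    where
    bound : ∀ u v → 𝟙 (adj G u v ∧ not (sameComponent u v)) ≤ 𝟙 (mem F u v)
    bound u v with adj G u v in e | mem F u v in m
    ... | false | _ = z≤n
    ... | true | true = 𝟙≤1 (not (sameComponent u v))
    ... | true | false
      rewrite connected⇒sameComponent (edge⇒connected (cong₂ (λ a b → a ∧ not b) e m)) = z≤n

  module Move (2≤s : 2 ≤ s) {a b a′ b′ : Fin n} (a~b : Twins G a b) (b~b′ : Twins G b b′)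
    (a≢a′ : a ≢ a′) (a-a′ : Connected A a a′) (b≢b′ : b ≢ b′) (b-b′ : Connected A b b′)
    (a≁b : ¬ Connected A a b) where

    private
      A′ : Fin n → Fin n → Bool
      A′ = adjDel G (relocate b a)

      r : Fin n → Fin n
      r = replace b b′

      a≢b : a ≢ b
      a≢b refl = a≁b (connected-refl a)

      outside-b : ∀ {z} → Connected A a z → z ≢ b
      outside-b a-z refl = a≁b a-z

      connected-r : ∀ v → Connected A v (r v)
      connected-r v with v ≟ b
      ... | yes refl = b-b′
      ... | no _ = connected-refl v

      r≢b : ∀ v → r v ≢ b
      r≢b v = replace-≢ v (b≢b′ ∘ sym)

      relocated-edge : ∀ {p q} → adj G p q ≡ true → Connected A (replace b a p) (replace b a q) →
        A′ p q ≡ true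
      relocated-edge e c = cut-edge⁺ G (relocated-sym b a) e (connected⇒sameComponent c)

      kept-edge : ∀ {p q} → A p q ≡ true → p ≢ b → q ≢ b → A′ p q ≡ true
      kept-edge e p≢b q≢b = relocated-edge (∧-trueˡ e)
        (subst₂ (Connected A) (sym (replace-other p≢b)) (sym (replace-other q≢b)) (edge⇒connected e))

      moved-edge : ∀ {z} → A a z ≡ true → A′ b z ≡ true
      moved-edge {z} e = relocated-edge
        (trans (sym (a~b z (adj⇒≢ G (∧-trueˡ e) ∘ sym) z≢b)) (∧-trueˡ e))
        (subst₂ (Connected A) (sym (replace-target b a)) (sym (replace-other z≢b)) (edge⇒connected e))
        where
        z≢b : z ≢ b
        z≢b = outside-b (edge⇒connected e)

      r-hom : ∀ {p q} → A p q ≡ true → r p ≡ r q ⊎ A′ (r p) (r q) ≡ true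
      r-hom {p} {q} e with r p ≟ r q
      ... | yes rp≡rq = inj₁ rp≡rq
      ... | no rp≢rq = inj₂ (relocated-edge
        (trans (replace-twin-adj {G = G} b~b′ rp≢rq) (∧-trueˡ e))
        (subst₂ (Connected A) (sym (replace-other (r≢b p))) (sym (replace-other (r≢b q)))
          (connected-trans (connected-sym (connected-r p))
            (connected-trans (edge⇒connected e) (connected-r q)))))

      moved-distLe-a : DistLe A′ s b a
      moved-distLe-a with firstStep a≢a′ (proj₂ a-a′)
      ... | z , e = 2 , 2≤s , step (moved-edge e)
        (step (kept-edge (trans (adjDel-sym G F z a) e) (outside-b (edge⇒connected e)) a≢b) here)

      moved-distLe-other : ∀ {v} → DistLe A s a v → v ≢ a → v ≢ b → DistLe A′ s b v
      moved-distLe-other (zero , _ , here) v≢a _ = ⊥-elim (v≢a refl)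
      moved-distLe-other (suc k , k<s , step {v = z} e p) _ v≢b with map-walk r r-hom p
      ... | j , j≤k , p′ = suc j , ≤-trans (s≤s j≤k) k<s , step (moved-edge e)
        (subst₂ (λ t t′ → Walk A′ t t′ j)
          (replace-other (outside-b (edge⇒connected e))) (replace-other v≢b) p′)

      moved-distLe : ∀ {v} → Connected A a v → v ≢ b → DistLe A′ s b v
      moved-distLe {v} a-v v≢b with v ≟ a
      ... | yes refl = moved-distLe-a
      ... | no v≢a = moved-distLe-other (valid a v a-v) v≢a v≢b

    -- Walks of G − F are pushed through b ↦ b′, which does not lengthen them, and walks leaving a
    -- are made to leave b instead; only b and a themselves need the detour b – z – a through a
    -- neighbour z of a.
    relocated⇒distLe : ∀ {u v} → (sameComponent on replace b a) u v ≡ true → DistLe A′ s u v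
    relocated⇒distLe {u} {v} uv with u ≟ b | v ≟ b
    -- The with-abstraction also evaluates the replacements in the type of uv.
    ... | yes refl | yes refl = 0 , z≤n , here
    ... | yes refl | no v≢b = moved-distLe (sameComponent⇒connected uv) v≢b
    ... | no u≢b | yes refl = distLe-sym (adjDel-sym G (relocate b a))
      (moved-distLe (connected-sym (sameComponent⇒connected uv)) u≢b)
    ... | no u≢b | no v≢b = subst₂ (DistLe A′ s) (replace-other u≢b) (replace-other v≢b)
      (map-distLe r r-hom (valid u v (sameComponent⇒connected uv)))

    relocate-keeps : ∀ {t} → Connected A a t → Connected A′ a t
    relocate-keeps a-t = distLe⇒connected (relocated⇒distLe
      (trans (cong₂ sameComponent (replace-fixes-target b a) (replace-other (outside-b a-t)))
        (connected⇒sameComponent a-t)))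

    relocate-joins : Connected A′ a b
    relocate-joins = distLe⇒connected (relocated⇒distLe
      (trans (cong₂ sameComponent (replace-fixes-target b a) (replace-target b a))
        (sameComponent-refl a)))

    relocate-valid : IsSClubCED s G (relocate b a)
    relocate-valid u v (_ , p) = relocated⇒distLe
      (cut-walk⇒related G (relocated-sym b a)
        (λ w → sameComponent-refl (replace b a w)) sameComponent-trans p)

  module _ (2≤s : 2 ≤ s) (minimal : ∀ F′ → IsSClubCED s G F′ → size F ≤ size F′)
    {x y x′ y′ : Fin n} (x~y : Twins G x y) (x~x′ : Twins G x x′) (y~y′ : Twins G y y′)
    (x≢x′ : x ≢ x′) (x-x′ : Connected A x x′) (y≢y′ : y ≢ y′) (y-y′ : Connected A y y′)
    (x≁y : ¬ Connected A x y) where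

    relocate-optimal : IsOptimal s G (relocate y x)
    relocate-optimal = valid₁ , λ F′ valid′ → ≤-trans size₁≤size (minimal F′ valid′)
      where
      valid₁ : IsSClubCED s G (relocate y x)
      valid₁ = Move.relocate-valid 2≤s x~y y~y′ x≢x′ x-x′ y≢y′ y-y′ x≁y
      valid₂ : IsSClubCED s G (relocate x y)
      valid₂ = Move.relocate-valid 2≤s (twins-sym {G = G} x~y) x~x′
        y≢y′ y-y′ x≢x′ x-x′ (x≁y ∘ connected-sym)
      S₁ S₂ : ℕ
      S₁ = size (relocate y x)
      S₂ = size (relocate x y)
      sizes : S₁ + S₂ ≤ size F + size F
      sizes = m+m≤n+n⇒m≤n (begin
        (S₁ + S₂) + (S₁ + S₂)
          ≡⟨ +-interchange S₁ S₂ ⟩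
        (S₁ + S₁) + (S₂ + S₂)
          ≡⟨ cong₂ _+_ (pairs-size (relocate y x)) (pairs-size (relocate x y)) ⟨
        cutCost G (sameComponent on replace y x) + cutCost G (sameComponent on replace x y)
          ≤⟨ cutCost-replace G sameComponent-sym x~y (sameComponent-refl x) (sameComponent-refl y) ⟩
        cutCost G sameComponent + cutCost G sameComponent
          ≤⟨ +-mono-≤ cutCost-components cutCost-components ⟩
        pairs (mem F) + pairs (mem F)
          ≡⟨ cong₂ _+_ (pairs-size F) (pairs-size F) ⟩
        (size F + size F) + (size F + size F) ∎)
        where open Data.Nat.Properties.≤-Reasoning
      size₁≤size : S₁ ≤ size F
      size₁≤size = m+n≤o+o⇒o≤n⇒m≤o sizes (minimal (relocate x y) valid₂)

module Gathering {s : ℕ} (2≤s : 2 ≤ s) {G : Graph n} {T : Fin n → Bool}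
  (twinClass : IsTwinClass G T) where

  Solution : Set
  Solution = Σ (EdgeSet G) λ F′ → IsOptimal s G F′ × AtMostOneComponentWithTwoOf G F′ T

  Companions : EdgeSet G → Fin n → Fin n → Set
  Companions F y y′ = T y ≡ true × T y′ ≡ true × y ≢ y′ × Connected (adjDel G F) y y′

  companions? : ∀ F → IsSClubCED s G F → ∀ y y′ → Dec (Companions F y y′)
  companions? F valid y y′ =
    (T y ≟ᵇ true) ×-dec (T y′ ≟ᵇ true) ×-dec ¬? (y ≟ y′) ×-dec Relocation.connected? G F valid y y′

  Stray : EdgeSet G → Fin n → Set
  Stray F x = ∃ λ y → ∃ λ y′ → Companions F y y′ × ¬ Connected (adjDel G F) x y

  stray? : ∀ F → IsSClubCED s G F → ∀ x → Dec (Stray F x)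
  stray? F valid x = any? λ y → any? λ y′ →
    companions? F valid y y′ ×-dec ¬? (Relocation.connected? G F valid x y)

  strayed : ∀ F → IsSClubCED s G F → Fin n → ℕ
  strayed F valid x = sum λ t → 𝟙 (T t ∧ not (Relocation.sameComponent G F valid x t))

  attracted⇒atMostOne : ∀ {F} {x} → (∀ {y y′} → Companions F y y′ → Connected (adjDel G F) x y) →
    AtMostOneComponentWithTwoOf G F T
  attracted⇒atMostOne {F} attracted x₁ x₂ y₁ y₂ T₁ T₂ T₃ T₄ x₁≢x₂ y₁≢y₂ x₁-x₂ y₁-y₂ =
    connected-trans (connected-sym (attracted (T₁ , T₂ , x₁≢x₂ , x₁-x₂)))
                    (attracted (T₃ , T₄ , y₁≢y₂ , y₁-y₂))
    where open Connectivity (adjDel-sym G F)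

  relocate-improves : ∀ F (optimal : IsOptimal s G F) {x x′ y y′} →
    Companions F x x′ → Companions F y y′ → ¬ Connected (adjDel G F) x y →
    Σ (EdgeSet G) λ F₁ → Σ (IsOptimal s G F₁) λ optimal₁ →
      Companions F₁ x x′ × strayed F₁ (proj₁ optimal₁) x < strayed F (proj₁ optimal) x
  relocate-improves F (valid , minimal) {x = x} {y = y} {y′ = y′}
    (Tx , Tx′ , x≢x′ , x-x′) (Ty , Ty′ , y≢y′ , y-y′) x≁y =
    relocate y x , optimal₁ , (Tx , Tx′ , x≢x′ , relocate-keeps x-x′) , fewer
    where
    open Relocation G F valid
    x~y : Twins G x y
    x~y = twinClass⇒twins {G = G} twinClass Tx Ty
    y~y′ : Twins G y y′
    y~y′ = twinClass⇒twins {G = G} twinClass Ty Ty′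
    optimal₁ : IsOptimal s G (relocate y x)
    optimal₁ = relocate-optimal 2≤s minimal x~y (twinClass⇒twins {G = G} twinClass Tx Tx′) y~y′
      x≢x′ x-x′ y≢y′ y-y′ x≁y
    module C₁ = Relocation G (relocate y x) (proj₁ optimal₁)
    open Move 2≤s x~y y~y′ x≢x′ x-x′ y≢y′ y-y′ x≁y using (relocate-keeps; relocate-joins)
    joined : 𝟙 (T y ∧ not (C₁.sameComponent x y)) < 𝟙 (T y ∧ not (sameComponent x y))
    joined rewrite Ty | C₁.connected⇒sameComponent relocate-joins | ¬connected⇒¬sameComponent x≁y =
      s≤s z≤n
    fewer : strayed (relocate y x) (proj₁ optimal₁) x < strayed F valid x
    fewer = ∑-mono-< (λ t → 𝟙-∧-not-antitone (T t)
      (C₁.connected⇒sameComponent ∘ relocate-keeps ∘ sameComponent⇒connected)) y joined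

  gather : ∀ k F (optimal : IsOptimal s G F) {x x′} → Companions F x x′ →
    strayed F (proj₁ optimal) x < k → Solution
  gather (suc k) F optimal {x} x,x′ bound with stray? F (proj₁ optimal) x
  ... | no none = F , optimal , attracted⇒atMostOne {F = F} attracted
    where
    attracted : ∀ {y y′} → Companions F y y′ → Connected (adjDel G F) x y
    attracted {y} {y′} y,y′ with Relocation.connected? G F (proj₁ optimal) x y
    ... | yes x-y = x-y
    ... | no x≁y = ⊥-elim (none (y , y′ , y,y′ , x≁y))
  ... | yes (y , y′ , y,y′ , x≁y) with relocate-improves F optimal x,x′ y,y′ x≁y
  ...   | F₁ , optimal₁ , x,x′₁ , fewer =
    gather k F₁ optimal₁ x,x′₁ (<-≤-trans fewer (≤-pred bound))

mainTheorem6 : (n s : ℕ) → 2 ≤ s → (G : Graph n) → (F : EdgeSet G) →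
    IsOptimal s G F → (T : Fin n → Bool) → IsTwinClass G T →
    Σ (EdgeSet G) (λ F' → IsOptimal s G F' × AtMostOneComponentWithTwoOf G F' T)
mainTheorem6 n s 2≤s G F optimal T twinClass = start (any? λ x → any? (companions? F valid x))
  where
  open Gathering 2≤s twinClass
  valid : IsSClubCED s G F
  valid = proj₁ optimal
  start : Dec (∃ λ x → ∃ (Companions F x)) → Solution
  start (yes (x , x′ , x,x′)) = gather (suc (strayed F valid x)) F optimal x,x′ ≤-refl
  start (no none) = F , optimal , λ x₁ x₂ _ _ T₁ T₂ _ _ x₁≢x₂ _ x₁-x₂ _ →
    ⊥-elim (none (x₁ , x₂ , T₁ , T₂ , x₁≢x₂ , x₁-x₂))
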